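{- Let $\mathbf E$ be a finite reading event model. For every formula $\theta$ of $LD\preceq E$ there is a formula $\theta'$ of $LD\preceq$ (containing no dynamic modalities) such that $\theta\leftrightarrow\theta'$ is derivable in $\mathbf{LD\preceq E}$.
   Context: Fix a finite set $A$ of agents and atoms $Prop$. A reading event model is $\mathbf E=(E,(\sim_a)_{a\in A},\underline\bullet)$, $E$ finite, $\sim_a$ equivalence relations on $E$, each $e$ assigned $\underline e:A\to\mathcal P(A)$ with $a\in\underline e(a)$, and $e\sim_af$ implies $\underline e(a)=\underline f(a)$; $\underline e(B):=\bigcup_{b\in B}\underline e(b)$; $\sim_B:=\bigcap_{b\in B}\sim_b$ on $E$; $B\preceq^eC$ means: for all $f\in E$, $f\sim_Be$ implies $f\sim_Ce$. Language $LD\preceq E$: $\varphi::=p\mid\neg\varphi\mid\varphi\wedge\varphi\mid D_B\varphi\mid B\preceq C\mid[e]\varphi$ ($p\in Prop$, $B,C\subseteq A$, $e\in E$); $LD\preceq$ is its fragment without $[e]$. The system $\mathbf{LD\preceq E}$: classical propositional logic; for all $B,C,F\subseteq A$: from $\varphi$ infer $D_B\varphi$, $D_B(\varphi\to\psi)\to(D_B\varphi\to D_B\psi)$, $D_B\varphi\to\varphi$, $D_B\varphi\to D_BD_B\varphi$, $\neg D_B\varphi\to D_B\neg D_B\varphi$; $B\preceq C$ if $C\subseteq B$; $(B\preceq C\wedge B\preceq F)\to B\preceq C\cup F$; $(B\preceq C\wedge C\preceq F)\to B\preceq F$; $B\preceq C\to D_B(B\preceq C)$; $B\preceq C\to(D_C\varphi\to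 D_B\varphi)$; for each $e\in E$: from $\varphi$ infer $[e]\varphi$; $[e](\varphi\to\psi)\to([e]\varphi\to[e]\psi)$; $[e]p\leftrightarrow p$; $[e]\neg\varphi\leftrightarrow\neg[e]\varphi$; $[e](\varphi\wedge\psi)\leftrightarrow[e]\varphi\wedge[e]\psi$; $[e](B\preceq C)\leftrightarrow\underline e(B)\preceq\underline e(C)$ if $B\preceq^eC$; $[e](B\preceq C)\leftrightarrow\bot$ if not $B\preceq^eC$; $[e]D_B\varphi\leftrightarrow\bigwedge\{D_{\underline e(B)}[f]\varphi:f\sim_Be\}$. -}

module Defs where

open import Data.Bool using (Bool; true; false; not; _∧_)
open import Data.Nat using (ℕ)
open import Data.Fin using (Fin)
open import Data.Fin.Subset using (Subset; _∈_; _⊆_; _∪_; ⋃) renaming (⊥ to ∅)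
open import Data.Fin.Subset.Properties using (_∈?_)
open import Data.Fin.Properties using (all?)
open import Data.List using (List; []; _∷_; filter; allFin; map)
open import Relation.Binary.PropositionalEquality using (_≡_)
open import Relation.Binary.Structures using (IsEquivalence)
open import Relation.Nullary using (Dec; ¬_)
open import Relation.Nullary.Decidable using (_→-dec_)

-- Agents: A = Fin n.  Events: E = Fin m.  Atoms: an arbitrary type Atom.

record EventModel (n m : ℕ) : Set₁ where
  field
    _∼⟨_⟩_   : Fin m → Fin n → Fin m → Set
    ∼-dec    : ∀ e a f → Dec (e ∼⟨ a ⟩ f)
    ∼-equiv  : ∀ a → IsEquivalence (λ e f → e ∼⟨ a ⟩ f)
    read     : Fin m → Fin n → Subset n
    read-self : ∀ e a → a ∈ read e a
    read-∼   : ∀ e f a → e ∼⟨ a ⟩ f → read e a ≡ read f a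

  readSet : Fin m → Subset n → Subset n
  readSet e B = ⋃ (map (read e) (filter (_∈? B) (allFin n)))

  _∼[_]_ : Fin m → Subset n → Fin m → Set
  f ∼[ B ] e = ∀ b → b ∈ B → f ∼⟨ b ⟩ e

  ∼[]-dec : ∀ f B e → Dec (f ∼[ B ] e)
  ∼[]-dec f B e = all? (λ b → (b ∈? B) →-dec ∼-dec f b e)

  _⪯⟨_⟩_ : Subset n → Fin m → Subset n → Set
  B ⪯⟨ e ⟩ C = ∀ f → f ∼[ B ] e → f ∼[ C ] e

  related : Subset n → Fin m → List (Fin m)
  related B e = filter (λ f → ∼[]-dec f B e) (allFin m)

infix 9 ¬ᶠ_ [_]_
infixr 7 _∧ᶠ_
infix 8 _⪯_
data Form (n : ℕ) (Atom : Set) (m : ℕ) : Set where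
  atom : Atom → Form n Atom m
  ¬ᶠ_  : Form n Atom m → Form n Atom m
  _∧ᶠ_ : Form n Atom m → Form n Atom m → Form n Atom m
  D    : Subset n → Form n Atom m → Form n Atom m
  _⪯_  : Subset n → Subset n → Form n Atom m
  [_]_ : Fin m → Form n Atom m → Form n Atom m

data Static {n : ℕ} {Atom : Set} {m : ℕ} : Form n Atom m → Set where
  atom : ∀ p → Static (atom p)
  ¬ᶠ_  : ∀ {φ} → Static φ → Static (¬ᶠ φ)
  _∧ᶠ_ : ∀ {φ ψ} → Static φ → Static ψ → Static (φ ∧ᶠ ψ)
  D    : ∀ B {φ} → Static φ → Static (D B φ)
  _⪯_  : ∀ B C → Static (B ⪯ C)

module _ {n : ℕ} {Atom : Set} {m : ℕ} where
  infixr 4 _⇒_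
  infix 3 _⇔_
  _⇒_ : Form n Atom m → Form n Atom m → Form n Atom m
  φ ⇒ ψ = ¬ᶠ (φ ∧ᶠ ¬ᶠ ψ)

  _⇔_ : Form n Atom m → Form n Atom m → Form n Atom m
  φ ⇔ ψ = (φ ⇒ ψ) ∧ᶠ (ψ ⇒ φ)

  ⊥ᶠ : Form n Atom m
  ⊥ᶠ = (∅ ⪯ ∅) ∧ᶠ ¬ᶠ (∅ ⪯ ∅)

  ⊤ᶠ : Form n Atom m
  ⊤ᶠ = ¬ᶠ ⊥ᶠ

  ⋀ : List (Form n Atom m) → Form n Atom m
  ⋀ []       = ⊤ᶠ
  ⋀ (φ ∷ φs) = φ ∧ᶠ ⋀ φs

  -- Propositional (truth-table) evaluation: non-Boolean subformulas
  -- (atoms, D_B φ, B ⪯ C, [e] φ) are treated as propositional variables.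
  ⟦_⟧ : Form n Atom m → (Form n Atom m → Bool) → Bool
  ⟦ atom p ⟧   v = v (atom p)
  ⟦ ¬ᶠ φ ⟧     v = not (⟦ φ ⟧ v)
  ⟦ φ ∧ᶠ ψ ⟧   v = ⟦ φ ⟧ v ∧ ⟦ ψ ⟧ v
  ⟦ D B φ ⟧    v = v (D B φ)
  ⟦ B ⪯ C ⟧    v = v (B ⪯ C)
  ⟦ [ e ] φ ⟧  v = v ([ e ] φ)

  Taut : Form n Atom m → Set
  Taut φ = ∀ v → ⟦ φ ⟧ v ≡ true

module _ {n m : ℕ} {Atom : Set} (𝔼 : EventModel n m) where
  open EventModel 𝔼

  infix 0 ⊢_
  data ⊢_ : Form n Atom m → Set where
    taut  : ∀ {φ} → Taut φ → ⊢ φ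
    mp    : ∀ {φ ψ} → ⊢ (φ ⇒ ψ) → ⊢ φ → ⊢ ψ
    nec-D : ∀ {B φ} → ⊢ φ → ⊢ D B φ
    K-D   : ∀ {B φ ψ} → ⊢ (D B (φ ⇒ ψ) ⇒ (D B φ ⇒ D B ψ))
    T-D   : ∀ {B φ} → ⊢ (D B φ ⇒ φ)
    4-D   : ∀ {B φ} → ⊢ (D B φ ⇒ D B (D B φ))
    5-D   : ∀ {B φ} → ⊢ (¬ᶠ D B φ ⇒ D B (¬ᶠ D B φ))
    ⪯-incl  : ∀ {B C} → C ⊆ B → ⊢ (B ⪯ C)
    ⪯-union : ∀ {B C F} → ⊢ ((B ⪯ C ∧ᶠ B ⪯ F) ⇒ (B ⪯ (C ∪ F)))
    ⪯-trans : ∀ {B C F} → ⊢ ((B ⪯ C ∧ᶠ C ⪯ F) ⇒ (B ⪯ F))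
    ⪯-know  : ∀ {B C} → ⊢ ((B ⪯ C) ⇒ D B (B ⪯ C))
    ⪯-D     : ∀ {B C φ} → ⊢ ((B ⪯ C) ⇒ (D C φ ⇒ D B φ))
    nec-E  : ∀ {e φ} → ⊢ φ → ⊢ [ e ] φ
    K-E    : ∀ {e φ ψ} → ⊢ ([ e ] (φ ⇒ ψ) ⇒ ([ e ] φ ⇒ [ e ] ψ))
    E-atom : ∀ {e p} → ⊢ ([ e ] atom p ⇔ atom p)
    E-neg  : ∀ {e φ} → ⊢ ([ e ] (¬ᶠ φ) ⇔ ¬ᶠ [ e ] φ)
    E-and  : ∀ {e φ ψ} → ⊢ ([ e ] (φ ∧ᶠ ψ) ⇔ ([ e ] φ ∧ᶠ [ e ] ψ))
    E-⪯    : ∀ {e B C} → B ⪯⟨ e ⟩ C →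
             ⊢ ([ e ] (B ⪯ C) ⇔ (readSet e B ⪯ readSet e C))
    E-⋠    : ∀ {e B C} → ¬ (B ⪯⟨ e ⟩ C) →
             ⊢ ([ e ] (B ⪯ C) ⇔ ⊥ᶠ)
    E-D    : ∀ {e B φ} →
             ⊢ ([ e ] D B φ ⇔ ⋀ (map (λ f → D (readSet e B) ([ f ] φ)) (related B e)))

-- Reduction axioms push a dynamic modality [e] inward through a static
-- formula until it meets atoms or ⪯-formulas, where it disappears; the
-- D-axiom replaces [e] D_B ψ by D-formulas over [f] ψ for the finitely many
-- f ∼_B e, and ψ is a smaller static formula.  Translating innermost
-- modalities first, every formula is therefore provably equivalent to a
-- static one, because provable equivalence is a congruence for all
-- connectives (the modalities being normal).
module Submission where

open import Defs
open import Data.Bool using (Bool; true; false; not; _∧_)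
open import Data.Bool.Properties using (∧-conicalˡ; ∧-conicalʳ)
open import Data.Fin.Properties using (all?)
open import Data.List using (List; []; _∷_; map)
open import Data.Nat using (ℕ)
open import Data.Product using (Σ; _×_; _,_)
open import Data.Fin.Subset using () renaming (⊥ to ∅)
open import Relation.Binary.PropositionalEquality using (_≡_; refl; trans; cong; cong₂)
open import Relation.Nullary using (Dec; yes; no)
open import Relation.Nullary.Decidable using (_→-dec_)

infixr 4 _⇒ᵇ_
infix 3 _⇔ᵇ_

_⇒ᵇ_ : Bool → Bool → Bool
x ⇒ᵇ y = not (x ∧ not y)

_⇔ᵇ_ : Bool → Bool → Bool
x ⇔ᵇ y = (x ⇒ᵇ y) ∧ (y ⇒ᵇ x)

⇒ᵇ-intro : ∀ {x y} → (x ≡ true → y ≡ true) → (x ⇒ᵇ y) ≡ true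
⇒ᵇ-intro {false}         _ = refl
⇒ᵇ-intro {true} {true}  _ = refl
⇒ᵇ-intro {true} {false} h = h refl

⇔ᵇ-true⇒≡ : ∀ x y → (x ⇔ᵇ y) ≡ true → x ≡ y
⇔ᵇ-true⇒≡ false false _ = refl
⇔ᵇ-true⇒≡ true  true  _ = refl

≡⇒⇔ᵇ-true : ∀ x y → x ≡ y → (x ⇔ᵇ y) ≡ true
≡⇒⇔ᵇ-true false _ refl = refl
≡⇒⇔ᵇ-true true  _ refl = refl

module _ {n m : ℕ} {Atom : Set} (𝔼 : EventModel n m) where
  open EventModel 𝔼

  private
    F : Set
    F = Form n Atom m

    ⊢ᴱ_ : F → Set
    ⊢ᴱ_ = ⊢_ 𝔼

    infix 0 ⊢ᴱ_

  consequence : ∀ {φ ψ : F} →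
                (∀ v → ⟦ φ ⟧ v ≡ true → ⟦ ψ ⟧ v ≡ true) →
                ⊢ᴱ φ → ⊢ᴱ ψ
  consequence h = mp (taut λ v → ⇒ᵇ-intro (h v))

  consequence₂ : ∀ {φ ψ χ : F} →
                 (∀ v → ⟦ φ ⟧ v ≡ true → ⟦ ψ ⟧ v ≡ true → ⟦ χ ⟧ v ≡ true) →
                 ⊢ᴱ φ → ⊢ᴱ ψ → ⊢ᴱ χ
  consequence₂ h p q = mp (mp (taut λ v → ⇒ᵇ-intro λ x → ⇒ᵇ-intro (h v x)) p) q

  ⇔-sound : ∀ {φ ψ : F} v → ⟦ φ ⇔ ψ ⟧ v ≡ true → ⟦ φ ⟧ v ≡ ⟦ ψ ⟧ v
  ⇔-sound {φ} {ψ} v = ⇔ᵇ-true⇒≡ (⟦ φ ⟧ v) (⟦ ψ ⟧ v)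

  ⇔-complete : ∀ {φ ψ : F} v → ⟦ φ ⟧ v ≡ ⟦ ψ ⟧ v → ⟦ φ ⇔ ψ ⟧ v ≡ true
  ⇔-complete {φ} {ψ} v = ≡⇒⇔ᵇ-true (⟦ φ ⟧ v) (⟦ ψ ⟧ v)

  ⇔-refl : ∀ {φ : F} → ⊢ᴱ φ ⇔ φ
  ⇔-refl {φ} = taut λ v → ⇔-complete {φ} {φ} v refl

  ⇔-trans : ∀ {φ ψ χ : F} → ⊢ᴱ φ ⇔ ψ → ⊢ᴱ ψ ⇔ χ → ⊢ᴱ φ ⇔ χ
  ⇔-trans {φ} {ψ} {χ} = consequence₂ λ v p q →
    ⇔-complete {φ} {χ} v (trans (⇔-sound {φ} {ψ} v p) (⇔-sound {ψ} {χ} v q))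

  ⇔⇒⇒ : ∀ {φ ψ : F} → ⊢ᴱ φ ⇔ ψ → ⊢ᴱ φ ⇒ ψ
  ⇔⇒⇒ = consequence λ _ p → ∧-conicalˡ _ _ p

  ⇔⇒⇐ : ∀ {φ ψ : F} → ⊢ᴱ φ ⇔ ψ → ⊢ᴱ ψ ⇒ φ
  ⇔⇒⇐ = consequence λ _ p → ∧-conicalʳ _ _ p

  ⇒⇐⇒⇔ : ∀ {φ ψ : F} → ⊢ᴱ φ ⇒ ψ → ⊢ᴱ ψ ⇒ φ → ⊢ᴱ φ ⇔ ψ
  ⇒⇐⇒⇔ = consequence₂ λ _ p q → cong₂ _∧_ p q

  ¬-cong : ∀ {φ ψ : F} → ⊢ᴱ φ ⇔ ψ → ⊢ᴱ ¬ᶠ φ ⇔ ¬ᶠ ψ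
  ¬-cong {φ} {ψ} = consequence λ v p →
    ⇔-complete {¬ᶠ φ} {¬ᶠ ψ} v (cong not (⇔-sound {φ} {ψ} v p))

  ∧-cong : ∀ {φ φ′ ψ ψ′ : F} → ⊢ᴱ φ ⇔ φ′ → ⊢ᴱ ψ ⇔ ψ′ → ⊢ᴱ φ ∧ᶠ ψ ⇔ φ′ ∧ᶠ ψ′
  ∧-cong {φ} {φ′} {ψ} {ψ′} = consequence₂ λ v p q →
    ⇔-complete {φ ∧ᶠ ψ} {φ′ ∧ᶠ ψ′} v
      (cong₂ _∧_ (⇔-sound {φ} {φ′} v p) (⇔-sound {ψ} {ψ′} v q))

  □-cong : (□ : F → F) →
           (∀ {φ} → ⊢ᴱ φ → ⊢ᴱ □ φ) →
           (∀ {φ ψ} → ⊢ᴱ □ (φ ⇒ ψ) ⇒ (□ φ ⇒ □ ψ)) →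
           ∀ {φ ψ} → ⊢ᴱ φ ⇔ ψ → ⊢ᴱ □ φ ⇔ □ ψ
  □-cong □ nec K p = ⇒⇐⇒⇔ (mp K (nec (⇔⇒⇒ p))) (mp K (nec (⇔⇒⇐ p)))

  D-cong : ∀ {B} {φ ψ : F} → ⊢ᴱ φ ⇔ ψ → ⊢ᴱ D B φ ⇔ D B ψ
  D-cong {B} = □-cong (D B) nec-D K-D

  []-cong : ∀ {e} {φ ψ : F} → ⊢ᴱ φ ⇔ ψ → ⊢ᴱ [ e ] φ ⇔ [ e ] ψ
  []-cong {e} = □-cong ([ e ]_) nec-E K-E

  ⪯⟨⟩-dec : ∀ B e C → Dec (B ⪯⟨ e ⟩ C)
  ⪯⟨⟩-dec B e C = all? λ f → ∼[]-dec f B e →-dec ∼[]-dec f C e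

  StaticEquivalent : F → Set
  StaticEquivalent θ = Σ F λ θ′ → Static θ′ × (⊢ᴱ θ ⇔ θ′)

  static : ∀ {θ : F} → Static θ → StaticEquivalent θ
  static {θ} s = θ , s , ⇔-refl

  infixr 2 _⟨⇔⟩_

  _⟨⇔⟩_ : ∀ {θ χ : F} → ⊢ᴱ θ ⇔ χ → StaticEquivalent χ → StaticEquivalent θ
  p ⟨⇔⟩ (χ′ , s , q) = χ′ , s , ⇔-trans p q

  ¬ˢ_ : ∀ {θ : F} → StaticEquivalent θ → StaticEquivalent (¬ᶠ θ)
  ¬ˢ (θ′ , s , p) = ¬ᶠ θ′ , ¬ᶠ s , ¬-cong p

  _∧ˢ_ : ∀ {θ χ : F} → StaticEquivalent θ → StaticEquivalent χ →
         StaticEquivalent (θ ∧ᶠ χ)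
  (θ′ , s , p) ∧ˢ (χ′ , t , q) = θ′ ∧ᶠ χ′ , s ∧ᶠ t , ∧-cong p q

  Dˢ : ∀ B {θ : F} → StaticEquivalent θ → StaticEquivalent (D B θ)
  Dˢ B (θ′ , s , p) = D B θ′ , D B s , D-cong p

  ⊥ᶠ-static : Static {n} {Atom} {m} ⊥ᶠ
  ⊥ᶠ-static = (∅ ⪯ ∅) ∧ᶠ ¬ᶠ (∅ ⪯ ∅)

  ⋀ˢ : ∀ {X : Set} (xs : List X) (g : X → F) →
       (∀ x → StaticEquivalent (g x)) → StaticEquivalent (⋀ (map g xs))
  ⋀ˢ []       g h = static (¬ᶠ ⊥ᶠ-static)
  ⋀ˢ (x ∷ xs) g h = h x ∧ˢ ⋀ˢ xs g h

  [_]-reduce : ∀ e {ψ : F} → Static ψ → StaticEquivalent ([ e ] ψ)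
  [ e ]-reduce (atom p) = E-atom ⟨⇔⟩ static (atom p)
  [ e ]-reduce (¬ᶠ s)   = E-neg ⟨⇔⟩ ¬ˢ [ e ]-reduce s
  [ e ]-reduce (s ∧ᶠ t) = E-and ⟨⇔⟩ [ e ]-reduce s ∧ˢ [ e ]-reduce t
  [ e ]-reduce (D B s)  =
    E-D ⟨⇔⟩ ⋀ˢ (related B e) _ λ f → Dˢ (readSet e B) ([ f ]-reduce s)
  [ e ]-reduce (B ⪯ C) with ⪯⟨⟩-dec B e C
  ... | yes B⪯C = E-⪯ B⪯C ⟨⇔⟩ static (readSet e B ⪯ readSet e C)
  ... | no  B⋠C = E-⋠ B⋠C ⟨⇔⟩ static ⊥ᶠ-static

  toStatic : (θ : F) → StaticEquivalent θ
  toStatic (atom p)  = static (atom p)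
  toStatic (¬ᶠ θ)    = ¬ˢ toStatic θ
  toStatic (θ ∧ᶠ χ)  = toStatic θ ∧ˢ toStatic χ
  toStatic (D B θ)   = Dˢ B (toStatic θ)
  toStatic (B ⪯ C)   = static (B ⪯ C)
  toStatic ([ e ] θ) with toStatic θ
  ... | θ′ , s , p = []-cong p ⟨⇔⟩ [ e ]-reduce s

lemma8 : {n m : ℕ} {Atom : Set} (𝔼 : EventModel n m) (θ : Form n Atom m) →
         Σ (Form n Atom m) (λ θ′ → Static θ′ × (⊢_ 𝔼 (θ ⇔ θ′)))
lemma8 𝔼 θ = toStatic 𝔼 θ
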